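{- For every positive integer $n$, the smallest order of a simple connected $(4n-1)$-regular graph having \textbf{rna} number one is at most $12n-2$. Moreover, for $n=1$ this bound is attained: the smallest order of a simple connected cubic graph having \textbf{rna} number one is exactly $10$.
   Context: All graphs are simple, connected and undirected. For a graph $G$ of order $N$, the \textbf{rna} number $\sigma^{ - }(G)$ is the minimum, over all bijections $f: V(G)\to\{1,2,\dots,N\}$, of the number of edges $uv$ of $G$ such that $f(u)$ and $f(v)$ have different parity. -}

module Defs where

open import Data.Nat using (ℕ; _+_; _%_; _<ᵇ_; _≡ᵇ_; _≤_)
open import Data.Bool using (Bool; true; false; not; _∧_; if_then_else_; T)
open import Data.Fin using (Fin; toℕ)
open import Data.List using (List; map; allFin)
open import Data.Nat.ListAction using (sum)
open import Data.Product using (Σ; ∃; ∃-syntax; _×_)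
open import Function.Definitions using (Bijective)
open import Relation.Binary.PropositionalEquality using (_≡_)
open import Relation.Binary.Construct.Closure.ReflexiveTransitive using (Star)

record Graph (N : ℕ) : Set where
  field
    adj    : Fin N → Fin N → Bool
    sym    : ∀ u v → adj u v ≡ adj v u
    irrefl : ∀ v → adj v v ≡ false
open Graph public

bit : Bool → ℕ
bit b = if b then 1 else 0

degree : ∀ {N} → Graph N → Fin N → ℕ
degree {N} G v = sum (map (λ u → bit (adj G v u)) (allFin N))

Regular : ∀ {N} → Graph N → ℕ → Set
Regular {N} G k = ∀ (v : Fin N) → degree G v ≡ k

Connected : ∀ {N} → Graph N → Set
Connected {N} G = ∀ (u v : Fin N) → Star (λ x y → T (adj G x y)) u v

-- labels f(v) ∈ {1..N} are represented as toℕ (f v) + 1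
differentParity : ℕ → ℕ → Bool
differentParity a b = not ((a % 2) ≡ᵇ (b % 2))

oddEdges : ∀ {N} → Graph N → (Fin N → Fin N) → ℕ
oddEdges {N} G f =
  sum (map (λ u → sum (map (λ v →
     bit ((toℕ u <ᵇ toℕ v) ∧ adj G u v
          ∧ differentParity (toℕ (f u) + 1) (toℕ (f v) + 1)))
     (allFin N))) (allFin N))

RnaNumber : ∀ {N} → Graph N → ℕ → Set
RnaNumber {N} G k =
  (∃[ f ] (Bijective _≡_ _≡_ f × oddEdges G f ≡ k))
  × (∀ (f : Fin N → Fin N) → Bijective _≡_ _≡_ f → k ≤ oddEdges G f)

-- If σ⁻(G) = 1, the vertices S with odd labels are joined to the
-- rest by a single edge. For k-regular G, counting degrees inside S gives
-- k |S| = 2 e(S) + 1, and every vertex of S has at least k + 1 − |S| neighbours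
-- outside S, so (k + 1 − |S|) |S| ≤ 1. For k ≥ 2 this forces |S| ≥ k + 1, and
-- the parity of k |S| rules out |S| = k + 1. The same holds for the complement
-- of S, so the order is at least 2 (k + 2), which is 10 for cubic graphs.
--
-- Take two copies of the complement of P₃ ∪ p K₂, in which every
-- vertex has degree 2p + 1 except the centre of the P₃, and join the two
-- centres by an edge. The result is a connected (2p + 1)-regular graph on
-- 4p + 6 vertices; labelling one copy oddly and the other evenly leaves the
-- bridge as the only edge with labels of different parity, while connectivity
-- forces at least one such edge. For 2p + 1 = 4n − 1 the order is 8n + 2.

module Submission where

open import Defs renaming (sym to adj-sym)
open import Data.Nat using (ℕ; zero; suc; _+_; _*_; _∸_; _≤_; _<_; z≤n; s≤s; _<ᵇ_; _≡ᵇ_; _%_; _≤?_; NonZero)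
open import Data.Nat.Base using (>-nonZero; >-nonZero⁻¹)
open import Data.Nat.Properties hiding (_≟_)
open import Data.Nat.DivMod using (m%n<n; [m+kn]%n≡m%n)
open import Data.Nat.Tactic.RingSolver using (solve-∀)
import Data.Nat.ListAction as List
open import Data.Bool using (Bool; true; false; not; _∧_; T)
open import Data.Bool.Properties using (∧-zeroʳ; ∧-identityʳ; ∧-comm; not-involutive)
open import Data.Fin using (Fin; toℕ; _↑ˡ_; _↑ʳ_; combine; remQuot; quotient)
  renaming (zero to fzero; suc to fsuc)
open import Data.Fin.Properties using (_≟_; toℕ-injective; remQuot-combine; combine-remQuot; toℕ-combine)
open import Data.Fin.Patterns using (0F; 1F)
open import Data.List using (map; allFin; tabulate)
open import Data.List.Properties using (map-tabulate)
open import Data.Product using (Σ; ∃-syntax; _×_; _,_; proj₁; proj₂)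
open import Data.Sum using (inj₁; inj₂)
open import Data.Empty using (⊥-elim)
open import Function using (id; _∘_)
open import Function.Definitions using (Bijective)
import Function.Construct.Identity as Identity
open import Relation.Nullary using (does; yes; no; ofʸ; ofⁿ; contradiction)
open import Relation.Nullary.Decidable using (dec-true)
open import Relation.Binary.PropositionalEquality
open import Relation.Binary.Construct.Closure.ReflexiveTransitive
  using (Star; ε; _◅_; _◅◅_; gmap; fold; reverse)
open import Algebra.Properties.Semiring.Sum +-*-semiring
  using (sum-syntax; sum-cong-≗; ∑-distrib-+; ∑-comm; sum-replicate-zero; *-distribˡ-sum; *-distribʳ-sum)

sum-map-allFin : ∀ {n} (h : Fin n → ℕ) → List.sum (map h (allFin n)) ≡ ∑[ i < n ] h i
sum-map-allFin {n} h = trans (cong List.sum (map-tabulate id h)) (sum-tabulate h)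
  where
  sum-tabulate : ∀ {n} (h : Fin n → ℕ) → List.sum (tabulate h) ≡ ∑[ i < n ] h i
  sum-tabulate {zero}  h = refl
  sum-tabulate {suc n} h = cong (h fzero +_) (sum-tabulate (h ∘ fsuc))

degree-∑ : ∀ {N} (G : Graph N) u → degree G u ≡ ∑[ v < N ] bit (adj G u v)
degree-∑ G u = sum-map-allFin (λ v → bit (adj G u v))

∑-ones : ∀ n → ∑[ i < n ] 1 ≡ n
∑-ones zero    = refl
∑-ones (suc n) = cong suc (∑-ones n)

∑-mono-≤ : ∀ {n} {g h : Fin n → ℕ} → (∀ i → g i ≤ h i) → ∑[ i < n ] g i ≤ ∑[ i < n ] h i
∑-mono-≤ {zero}  g≤h = z≤n
∑-mono-≤ {suc n} g≤h = +-mono-≤ (g≤h fzero) (∑-mono-≤ (g≤h ∘ fsuc))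

≤-∑ : ∀ {n} (h : Fin n → ℕ) i → h i ≤ ∑[ j < n ] h j
≤-∑ h fzero    = m≤m+n (h fzero) _
≤-∑ h (fsuc i) = ≤-trans (≤-∑ (h ∘ fsuc) i) (m≤n+m _ (h fzero))

∑-↑ : ∀ m {n} (h : Fin (m + n) → ℕ) →
      ∑[ i < m + n ] h i ≡ ∑[ i < m ] h (i ↑ˡ n) + ∑[ j < n ] h (m ↑ʳ j)
∑-↑ zero    h = refl
∑-↑ (suc m) h = trans (cong (h fzero +_) (∑-↑ m (h ∘ fsuc))) (sym (+-assoc (h fzero) _ _))

∑-combine : ∀ m {n} (h : Fin (m * n) → ℕ) →
            ∑[ x < m * n ] h x ≡ ∑[ i < m ] ∑[ j < n ] h (combine i j)
∑-combine zero    h = refl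
∑-combine (suc m) {n} h =
  trans (∑-↑ n h) (cong (∑[ j < n ] h (j ↑ˡ (m * n)) +_) (∑-combine m (λ x → h (n ↑ʳ x))))

bit-not+bit : ∀ b → bit (not b) + bit b ≡ 1
bit-not+bit true  = refl
bit-not+bit false = refl

∧₃-reverse : ∀ a b c → (a ∧ b ∧ c) ≡ (c ∧ b ∧ a)
∧₃-reverse true  true  c     = sym (∧-identityʳ c)
∧₃-reverse true  false c     = sym (∧-zeroʳ c)
∧₃-reverse false b     true  = sym (∧-zeroʳ b)
∧₃-reverse false b     false = refl

≡ᵇ-sym : ∀ m n → (m ≡ᵇ n) ≡ (n ≡ᵇ m)
≡ᵇ-sym zero    zero    = refl
≡ᵇ-sym zero    (suc n) = refl
≡ᵇ-sym (suc m) zero    = refl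
≡ᵇ-sym (suc m) (suc n) = ≡ᵇ-sym m n

does-≟-sym : ∀ {n} (a b : Fin n) → does (a ≟ b) ≡ does (b ≟ a)
does-≟-sym a b with a ≟ b | b ≟ a
... | yes refl | yes _    = refl
... | yes refl | no b≢a   = contradiction refl b≢a
... | no a≢b   | yes refl = contradiction refl a≢b
... | no _     | no _     = refl

∑-delta : ∀ {n} (a : Fin n) → ∑[ i < n ] bit (does (i ≟ a)) ≡ 1
∑-delta {suc n} fzero    = cong suc (sum-replicate-zero n)
∑-delta {suc n} (fsuc a) = ∑-delta a

∑-delta-complement : ∀ {n} (a : Fin (suc n)) → ∑[ t < suc n ] bit (not (does (t ≟ a))) ≡ n
∑-delta-complement {n} a = +-cancelʳ-≡ 1 _ n (begin
  ∑[ t < suc n ] bit (not (does (t ≟ a))) + 1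
    ≡⟨ cong (∑[ t < suc n ] bit (not (does (t ≟ a))) +_) (sym (∑-delta a)) ⟩
  ∑[ t < suc n ] bit (not (does (t ≟ a))) + ∑[ t < suc n ] bit (does (t ≟ a))
    ≡⟨ sym (∑-distrib-+ (λ t → bit (not (does (t ≟ a)))) (λ t → bit (does (t ≟ a)))) ⟩
  ∑[ t < suc n ] (bit (not (does (t ≟ a))) + bit (does (t ≟ a)))
    ≡⟨ sum-cong-≗ (λ t → bit-not+bit (does (t ≟ a))) ⟩
  ∑[ t < suc n ] 1
    ≡⟨ trans (∑-ones (suc n)) (+-comm 1 n) ⟩
  n + 1 ∎)
  where open ≡-Reasoning

count-symmetric : ∀ {n} (Q : Fin n → Fin n → Bool) → (∀ u v → Q u v ≡ Q v u) → (∀ u → Q u u ≡ false) →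
  ∑[ u < n ] ∑[ v < n ] bit (Q u v) ≡ 2 * ∑[ u < n ] ∑[ v < n ] bit ((toℕ u <ᵇ toℕ v) ∧ Q u v)
count-symmetric {n} Q Q-sym Q-irrefl = begin
  ∑[ u < n ] ∑[ v < n ] bit (Q u v)
    ≡⟨ sum-cong-≗ (λ u → sum-cong-≗ (split-by-order u)) ⟩
  ∑[ u < n ] ∑[ v < n ] (ordered u v + ordered v u)
    ≡⟨ sum-cong-≗ (λ u → ∑-distrib-+ (ordered u) (λ v → ordered v u)) ⟩
  ∑[ u < n ] (∑[ v < n ] ordered u v + ∑[ v < n ] ordered v u)
    ≡⟨ ∑-distrib-+ (λ u → ∑[ v < n ] ordered u v) (λ u → ∑[ v < n ] ordered v u) ⟩
  E + ∑[ u < n ] ∑[ v < n ] ordered v u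
    ≡⟨ cong (E +_) (trans (∑-comm (λ u v → ordered v u)) (sym (+-identityʳ E))) ⟩
  2 * E ∎
  where
  open ≡-Reasoning
  ordered : Fin n → Fin n → ℕ
  ordered u v = bit ((toℕ u <ᵇ toℕ v) ∧ Q u v)
  E : ℕ
  E = ∑[ u < n ] ∑[ v < n ] ordered u v
  split-by-order : ∀ u v → bit (Q u v) ≡ ordered u v + ordered v u
  split-by-order u v
    with toℕ u <ᵇ toℕ v | <ᵇ-reflects-< (toℕ u) (toℕ v)
       | toℕ v <ᵇ toℕ u | <ᵇ-reflects-< (toℕ v) (toℕ u)
  ... | true  | ofʸ u<v | true  | ofʸ v<u = contradiction v<u (<-asym u<v)
  ... | true  | _       | false | _       = sym (+-identityʳ _)
  ... | false | _       | true  | _       = cong bit (Q-sym u v)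
  ... | false | ofⁿ u≮v | false | ofⁿ v≮u
    rewrite toℕ-injective (≤-antisym (≮⇒≥ v≮u) (≮⇒≥ u≮v)) = cong bit (Q-irrefl v)

-- Edges whose labels have different parity

Walk : ∀ {N} → Graph N → Fin N → Fin N → Set
Walk G = Star (λ x y → T (adj G x y))

label : ∀ {N} → (Fin N → Fin N) → Fin N → ℕ
label f u = toℕ (f u) + 1

oddLabel : ∀ {N} → (Fin N → Fin N) → Fin N → Bool
oddLabel f u = label f u % 2 ≡ᵇ 1

crossing : ∀ {N} → Graph N → (Fin N → Fin N) → Fin N → Fin N → Bool
crossing G f u v = adj G u v ∧ differentParity (label f u) (label f v)

crossing-sym : ∀ {N} (G : Graph N) f u v → crossing G f u v ≡ crossing G f v u
crossing-sym G f u v = cong₂ _∧_ (adj-sym G u v) (cong not (≡ᵇ-sym (label f u % 2) (label f v % 2)))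

crossing-irrefl : ∀ {N} (G : Graph N) f u → crossing G f u u ≡ false
crossing-irrefl G f u rewrite irrefl G u = refl

crossing-count : ∀ {N} (G : Graph N) f → ∑[ u < N ] ∑[ v < N ] bit (crossing G f u v) ≡ 2 * oddEdges G f
crossing-count {N} G f = trans
  (count-symmetric (crossing G f) (crossing-sym G f) (crossing-irrefl G f))
  (cong (2 *_) (sym (trans (sum-map-allFin (λ u → List.sum (map (ordered u) (allFin N))))
                           (sum-cong-≗ (λ u → sum-map-allFin (ordered u))))))
  where
  ordered : Fin N → Fin N → ℕ
  ordered u v = bit ((toℕ u <ᵇ toℕ v) ∧ crossing G f u v)

no-crossing⇒same-parity : ∀ {N} (G : Graph N) f u v → T (adj G u v) →
  crossing G f u v ≡ false → label f u % 2 ≡ label f v % 2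
no-crossing⇒same-parity G f u v uv no-cross with adj G u v
... | true = ≡ᵇ⇒≡ _ _ (subst T (sym (trans (sym (not-involutive _)) (cong not no-cross))) _)

oddEdges-positive : ∀ {n} (G : Graph (suc (suc n))) → Connected G →
  ∀ f → Bijective _≡_ _≡_ f → 1 ≤ oddEdges G f
oddEdges-positive G connected f (_ , surjective) with oddEdges G f in no-odd-edge
... | suc _ = s≤s z≤n
... | zero  = contradiction (walk-parity (connected labelled-1 labelled-2)) different-labels
  where
  labelled-1 = proj₁ (surjective fzero)
  labelled-2 = proj₁ (surjective (fsuc fzero))
  different-labels : label f labelled-1 % 2 ≢ label f labelled-2 % 2
  different-labels rewrite proj₂ (surjective fzero) refl | proj₂ (surjective (fsuc fzero)) refl = λ ()
  no-crossing : ∀ u v → crossing G f u v ≡ false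
  no-crossing u v = bit≤0 (crossing G f u v) (begin
    bit (crossing G f u v)                         ≤⟨ ≤-∑ (λ w → bit (crossing G f u w)) v ⟩
    ∑[ w < _ ] bit (crossing G f u w)              ≤⟨ ≤-∑ (λ x → ∑[ w < _ ] bit (crossing G f x w)) u ⟩
    ∑[ x < _ ] ∑[ w < _ ] bit (crossing G f x w)   ≡⟨ trans (crossing-count G f) (cong (2 *_) no-odd-edge) ⟩
    0                                              ∎)
    where
    open ≤-Reasoning
    bit≤0 : ∀ b → bit b ≤ 0 → b ≡ false
    bit≤0 false _ = refl
  walk-parity : ∀ {u v} → Walk G u v → label f u % 2 ≡ label f v % 2
  walk-parity = fold (λ u v → label f u % 2 ≡ label f v % 2)
    (λ {u} {v} uv → trans (no-crossing⇒same-parity G f u v uv (no-crossing u v))) refl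

-- Cuts in regular graphs

size : ∀ {N} → (Fin N → Bool) → ℕ
size {N} S = ∑[ u < N ] bit (S u)

cut : ∀ {N} → Graph N → (Fin N → Bool) → ℕ
cut {N} G S = ∑[ u < N ] ∑[ v < N ] bit (S u ∧ adj G u v ∧ not (S v))

inside : ∀ {N} → Graph N → (Fin N → Bool) → Fin N → ℕ
inside {N} G S u = ∑[ v < N ] bit (S u ∧ adj G u v ∧ S v)

outside : ∀ {N} → Graph N → (Fin N → Bool) → Fin N → ℕ
outside {N} G S u = ∑[ v < N ] bit (S u ∧ adj G u v ∧ not (S v))

size-complement : ∀ {N} (S : Fin N → Bool) → size (not ∘ S) + size S ≡ N
size-complement {N} S =
  trans (sym (∑-distrib-+ (λ u → bit (not (S u))) (λ u → bit (S u))))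
        (trans (sum-cong-≗ (bit-not+bit ∘ S)) (∑-ones N))

cut-complement : ∀ {N} (G : Graph N) S → cut G (not ∘ S) ≡ cut G S
cut-complement {N} G S = trans
  (sum-cong-≗ λ u → sum-cong-≗ λ v → cong bit (begin
    not (S u) ∧ adj G u v ∧ not (not (S v)) ≡⟨ cong (λ b → not (S u) ∧ adj G u v ∧ b) (not-involutive (S v)) ⟩
    not (S u) ∧ adj G u v ∧ S v             ≡⟨ ∧₃-reverse (not (S u)) (adj G u v) (S v) ⟩
    S v ∧ adj G u v ∧ not (S u)             ≡⟨ cong (λ b → S v ∧ b ∧ not (S u)) (adj-sym G u v) ⟩
    S v ∧ adj G v u ∧ not (S u)             ∎))
  (∑-comm (λ u v → bit (S v ∧ adj G v u ∧ not (S u))))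
  where open ≡-Reasoning

degree-split : ∀ {N k} (G : Graph N) → Regular G k → ∀ S u → bit (S u) * k ≡ inside G S u + outside G S u
degree-split {N} {k} G regular S u = begin
  bit (S u) * k                              ≡⟨ cong (bit (S u) *_) (trans (sym (regular u)) (degree-∑ G u)) ⟩
  bit (S u) * ∑[ v < N ] bit (adj G u v)     ≡⟨ *-distribˡ-sum (bit (S u)) (λ v → bit (adj G u v)) ⟩
  ∑[ v < N ] (bit (S u) * bit (adj G u v))   ≡⟨ sum-cong-≗ (λ v → bit-split (S u) (adj G u v) (S v)) ⟩
  ∑[ v < N ] (bit (S u ∧ adj G u v ∧ S v) + bit (S u ∧ adj G u v ∧ not (S v)))
    ≡⟨ ∑-distrib-+ (λ v → bit (S u ∧ adj G u v ∧ S v)) (λ v → bit (S u ∧ adj G u v ∧ not (S v))) ⟩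
  inside G S u + outside G S u               ∎
  where
  open ≡-Reasoning
  bit-split : ∀ a b c → bit a * bit b ≡ bit (a ∧ b ∧ c) + bit (a ∧ b ∧ not c)
  bit-split true  true  true  = refl
  bit-split true  true  false = refl
  bit-split true  false c     = refl
  bit-split false b     c     = refl

handshake-cut : ∀ {N k} (G : Graph N) → Regular G k → ∀ S → ∃[ e ] size S * k ≡ 2 * e + cut G S
handshake-cut {N} {k} G regular S = e , (begin
  size S * k                                  ≡⟨ *-distribʳ-sum k (λ u → bit (S u)) ⟩
  ∑[ u < N ] (bit (S u) * k)                  ≡⟨ sum-cong-≗ (degree-split G regular S) ⟩
  ∑[ u < N ] (inside G S u + outside G S u)   ≡⟨ ∑-distrib-+ (inside G S) (outside G S) ⟩
  ∑[ u < N ] inside G S u + cut G S           ≡⟨ cong (_+ cut G S) (count-symmetric Q Q-sym Q-irrefl) ⟩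
  2 * e + cut G S                             ∎)
  where
  open ≡-Reasoning
  Q : Fin N → Fin N → Bool
  Q u v = S u ∧ adj G u v ∧ S v
  Q-sym : ∀ u v → Q u v ≡ Q v u
  Q-sym u v = trans (∧₃-reverse (S u) (adj G u v) (S v)) (cong (λ b → S v ∧ b ∧ S u) (adj-sym G u v))
  Q-irrefl : ∀ u → Q u u ≡ false
  Q-irrefl u rewrite irrefl G u = ∧-zeroʳ (S u)
  e : ℕ
  e = ∑[ u < N ] ∑[ v < N ] bit ((toℕ u <ᵇ toℕ v) ∧ Q u v)

inside<size : ∀ {N} (G : Graph N) S u → S u ≡ true → inside G S u < size S
inside<size {N} G S u u∈S = begin
  suc (inside G S u)                                              ≡⟨ +-comm 1 (inside G S u) ⟩
  inside G S u + 1                                                ≡⟨ cong (inside G S u +_) (sym (∑-delta u)) ⟩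
  inside G S u + ∑[ v < N ] bit (does (v ≟ u))                    ≡⟨ sym (∑-distrib-+ (λ v → bit (S u ∧ adj G u v ∧ S v)) _) ⟩
  ∑[ v < N ] (bit (S u ∧ adj G u v ∧ S v) + bit (does (v ≟ u)))   ≤⟨ ∑-mono-≤ term≤ ⟩
  size S                                                          ∎
  where
  open ≤-Reasoning
  term≤ : ∀ v → bit (S u ∧ adj G u v ∧ S v) + bit (does (v ≟ u)) ≤ bit (S v)
  term≤ v with v ≟ u
  ... | yes refl rewrite irrefl G v | u∈S = ≤-refl
  ... | no _ with S u | adj G u v | S v
  ...   | true  | true  | true  = ≤-refl
  ...   | true  | true  | false = z≤n
  ...   | true  | false | _     = z≤n
  ...   | false | _     | _     = z≤n

outside-bound : ∀ {N k} (G : Graph N) → Regular G k → ∀ S u → (suc k ∸ size S) * bit (S u) ≤ outside G S u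
outside-bound {N} {k} G regular S u = by-membership (S u) refl
  where
  open ≤-Reasoning
  by-membership : ∀ b → S u ≡ b → (suc k ∸ size S) * bit b ≤ outside G S u
  by-membership false _ = ≤-trans (≤-reflexive (*-zeroʳ (suc k ∸ size S))) z≤n
  by-membership true u∈S = ≤-trans (≤-reflexive (*-identityʳ (suc k ∸ size S)))
    (m≤n+o⇒m∸n≤o (suc k) (size S) (begin
      suc k                                ≡⟨ cong suc (trans (sym (*-identityˡ k)) k-split) ⟩
      suc (inside G S u + outside G S u)   ≤⟨ +-monoˡ-≤ (outside G S u) (inside<size G S u u∈S) ⟩
      size S + outside G S u               ∎))
    where
    k-split : 1 * k ≡ inside G S u + outside G S u
    k-split = subst (λ b → bit b * k ≡ inside G S u + outside G S u) u∈S (degree-split G regular S u)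

cut-lower-bound : ∀ {N k} (G : Graph N) → Regular G k → ∀ S → (suc k ∸ size S) * size S ≤ cut G S
cut-lower-bound {N} {k} G regular S =
  subst (_≤ cut G S) (sym (*-distribˡ-sum (suc k ∸ size S) (λ u → bit (S u))))
        (∑-mono-≤ (outside-bound G regular S))

consecutive-product-even : ∀ n → ∃[ m ] suc n * n ≡ 2 * m
consecutive-product-even zero = 0 , refl
consecutive-product-even (suc n) with consecutive-product-even n
... | m , even = m + suc n , (begin
  suc (suc n) * suc n     ≡⟨ expand n ⟩
  suc n * n + 2 * suc n   ≡⟨ cong (_+ 2 * suc n) even ⟩
  2 * m + 2 * suc n       ≡⟨ sym (*-distribˡ-+ 2 m (suc n)) ⟩
  2 * (m + suc n)         ∎)
  where
  open ≡-Reasoning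
  expand : ∀ n → suc (suc n) * suc n ≡ suc n * n + 2 * suc n
  expand = solve-∀

parity-and-cut⇒2+k≤s : ∀ k s e → 2 ≤ k → s * k ≡ suc (2 * e) → (suc k ∸ s) * s ≤ 1 → 2 + k ≤ s
parity-and-cut⇒2+k≤s k s e 2≤k odd product≤1 with 2 + k ≤? s
... | yes 2+k≤s = 2+k≤s
... | no 2+k≰s with m≤n⇒m<n∨m≡n (≤-pred (≰⇒> 2+k≰s))
...   | inj₂ refl = ⊥-elim (even≢odd m e (trans (sym even) odd))
  where
  m = proj₁ (consecutive-product-even k)
  even = proj₂ (consecutive-product-even k)
...   | inj₁ s<1+k = small s (≤-pred s<1+k) odd product≤1
  where
  -- Both factors of (k + 1 − s) s are positive, so both are 1, forcing k = 1.
  small : ∀ s → s ≤ k → s * k ≡ suc (2 * e) → (suc k ∸ s) * s ≤ 1 → 2 + k ≤ s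
  small zero _ () _
  small (suc s) s<k _ product≤1 = contradiction k≡1 (λ k≡1 → <⇒≢ 2≤k (sym k≡1))
    where
    instance
      _ : NonZero (k ∸ s)
      _ = >-nonZero (m<n⇒0<n∸m s<k)
    product≡1 : (k ∸ s) * suc s ≡ 1
    product≡1 = ≤-antisym product≤1 (>-nonZero⁻¹ _ {{m*n≢0 (k ∸ s) (suc s)}})
    s≡0 : s ≡ 0
    s≡0 = suc-injective (m*n≡1⇒n≡1 (k ∸ s) (suc s) product≡1)
    k≡1 : k ≡ 1
    k≡1 = trans (sym (cong (k ∸_) s≡0)) (m*n≡1⇒m≡1 (k ∸ s) (suc s) product≡1)

isolated-set-size : ∀ {N k} (G : Graph N) → Regular G k → 2 ≤ k → ∀ S → cut G S ≡ 1 → 2 + k ≤ size S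
isolated-set-size {k = k} G regular 2≤k S cut≡1 with handshake-cut G regular S
... | e , handshake = parity-and-cut⇒2+k≤s k (size S) e 2≤k
  (trans handshake (trans (cong (2 * e +_) cut≡1) (+-comm (2 * e) 1)))
  (subst ((suc k ∸ size S) * size S ≤_) cut≡1 (cut-lower-bound G regular S))

crossing-cuts : ∀ {N} (G : Graph N) f → 2 * oddEdges G f ≡ cut G (oddLabel f) + cut G (not ∘ oddLabel f)
crossing-cuts {N} G f = begin
  2 * oddEdges G f                               ≡⟨ sym (crossing-count G f) ⟩
  ∑[ u < N ] ∑[ v < N ] bit (crossing G f u v)   ≡⟨ sum-cong-≗ (λ u → sum-cong-≗ (λ v →
                                                      xor-split (adj G u v) (m%n<n (label f u) 2) (m%n<n (label f v) 2))) ⟩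
  ∑[ u < N ] ∑[ v < N ] (leaving u v + entering u v)
                                                 ≡⟨ sum-cong-≗ (λ u → ∑-distrib-+ (leaving u) (entering u)) ⟩
  ∑[ u < N ] (∑[ v < N ] leaving u v + ∑[ v < N ] entering u v)
                                                 ≡⟨ ∑-distrib-+ (λ u → ∑[ v < N ] leaving u v) (λ u → ∑[ v < N ] entering u v) ⟩
  cut G S + cut G (not ∘ S)                      ∎
  where
  open ≡-Reasoning
  S = oddLabel f
  leaving entering : Fin N → Fin N → ℕ
  leaving  u v = bit (S u ∧ adj G u v ∧ not (S v))
  entering u v = bit (not (S u) ∧ adj G u v ∧ not (not (S v)))
  xor-split : ∀ a {p q} → p < 2 → q < 2 →
    bit (a ∧ not (p ≡ᵇ q)) ≡ bit ((p ≡ᵇ 1) ∧ a ∧ not (q ≡ᵇ 1)) + bit (not (p ≡ᵇ 1) ∧ a ∧ not (not (q ≡ᵇ 1)))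
  xor-split false {0} {0} _ _ = refl
  xor-split false {0} {1} _ _ = refl
  xor-split false {1} {0} _ _ = refl
  xor-split false {1} {1} _ _ = refl
  xor-split true  {0} {0} _ _ = refl
  xor-split true  {0} {1} _ _ = refl
  xor-split true  {1} {0} _ _ = refl
  xor-split true  {1} {1} _ _ = refl
  xor-split _ {suc (suc _)} (s≤s (s≤s ())) _
  xor-split _ {_} {suc (suc _)} _ (s≤s (s≤s ()))

oddEdges≡cut : ∀ {N} (G : Graph N) f → oddEdges G f ≡ cut G (oddLabel f)
oddEdges≡cut G f = *-cancelˡ-≡ (oddEdges G f) (cut G S) 2 (begin
  2 * oddEdges G f             ≡⟨ crossing-cuts G f ⟩
  cut G S + cut G (not ∘ S)    ≡⟨ cong (cut G S +_) (trans (cut-complement G S) (sym (+-identityʳ (cut G S)))) ⟩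
  2 * cut G S                  ∎)
  where
  open ≡-Reasoning
  S = oddLabel f

rna≡1⇒order-bound : ∀ {N k} (G : Graph N) → Regular G k → 2 ≤ k → RnaNumber G 1 → 2 * (2 + k) ≤ N
rna≡1⇒order-bound {N} {k} G regular 2≤k ((f , _ , one-odd-edge) , _) = begin
  2 * (2 + k)                  ≡⟨ cong ((2 + k) +_) (+-identityʳ (2 + k)) ⟩
  (2 + k) + (2 + k)            ≤⟨ +-mono-≤ (isolated-set-size G regular 2≤k (not ∘ S) (trans (cut-complement G S) cut≡1))
                                           (isolated-set-size G regular 2≤k S cut≡1) ⟩
  size (not ∘ S) + size S      ≡⟨ size-complement S ⟩
  N                            ∎
  where
  open ≤-Reasoning
  S = oddLabel f
  cut≡1 : cut G S ≡ 1
  cut≡1 = trans (sym (oddEdges≡cut G f)) one-odd-edge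

-- Construction: two copies of a graph joined by a bridge

hub⇒connected : ∀ {N} (G : Graph N) (h : Fin N) → (∀ v → Walk G v h) → Connected G
hub⇒connected G h to-hub u v = to-hub u ◅◅ reverse (λ {x} {y} → subst T (adj-sym G x y)) (to-hub v)

-- Copy s of vertex i is combine i s, of index 2i + s, so under the identity
-- labelling the two copies are the two parity classes.
module BridgedDouble {m} (H : Graph m) (c : Fin m) where

  isCentre : Fin m → Bool
  isCentre i = does (i ≟ c)

  link : Fin m × Fin 2 → Fin m × Fin 2 → Bool
  link (i , 0F) (j , 0F) = adj H i j
  link (i , 1F) (j , 1F) = adj H i j
  link (i , _ ) (j , _ ) = isCentre i ∧ isCentre j

  link-sym : ∀ p q → link p q ≡ link q p
  link-sym (i , 0F) (j , 0F) = adj-sym H i j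
  link-sym (i , 1F) (j , 1F) = adj-sym H i j
  link-sym (i , 0F) (j , 1F) = ∧-comm (isCentre i) (isCentre j)
  link-sym (i , 1F) (j , 0F) = ∧-comm (isCentre i) (isCentre j)

  link-irrefl : ∀ p → link p p ≡ false
  link-irrefl (i , 0F) = irrefl H i
  link-irrefl (i , 1F) = irrefl H i

  graph : Graph (m * 2)
  graph = record
    { adj    = λ x y → link (remQuot 2 x) (remQuot 2 y)
    ; sym    = λ x y → link-sym (remQuot 2 x) (remQuot 2 y)
    ; irrefl = λ x → link-irrefl (remQuot 2 x)
    }

  adj-combine : ∀ (i : Fin m) (s : Fin 2) (j : Fin m) (t : Fin 2) →
                adj graph (combine i s) (combine j t) ≡ link (i , s) (j , t)
  adj-combine i s j t rewrite remQuot-combine {k = 2} i s | remQuot-combine {k = 2} j t = refl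

  ∑-centre : ∀ b → ∑[ j < m ] bit (b ∧ isCentre j) ≡ bit b
  ∑-centre true  = ∑-delta c
  ∑-centre false = sum-replicate-zero m

  degree-lift : ∀ (i : Fin m) (s : Fin 2) → ∑[ j < m ] ∑[ t < 2 ] bit (link (i , s) (j , t)) ≡ degree H i + bit (isCentre i)
  degree-lift i s = begin
    ∑[ j < m ] ∑[ t < 2 ] bit (link (i , s) (j , t))
      ≡⟨ sum-cong-≗ (both-sides s) ⟩
    ∑[ j < m ] (bit (adj H i j) + bit (isCentre i ∧ isCentre j))
      ≡⟨ ∑-distrib-+ (λ j → bit (adj H i j)) (λ j → bit (isCentre i ∧ isCentre j)) ⟩
    ∑[ j < m ] bit (adj H i j) + ∑[ j < m ] bit (isCentre i ∧ isCentre j)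
      ≡⟨ cong₂ _+_ (sym (degree-∑ H i)) (∑-centre (isCentre i)) ⟩
    degree H i + bit (isCentre i) ∎
    where
    open ≡-Reasoning
    both-sides : ∀ s j → ∑[ t < 2 ] bit (link (i , s) (j , t)) ≡ bit (adj H i j) + bit (isCentre i ∧ isCentre j)
    both-sides 0F j = cong (bit (adj H i j) +_) (+-identityʳ _)
    both-sides 1F j = trans (cong (bit (isCentre i ∧ isCentre j) +_) (+-identityʳ _))
                            (+-comm (bit (isCentre i ∧ isCentre j)) (bit (adj H i j)))

  regular : ∀ {k} → (∀ i → degree H i + bit (isCentre i) ≡ k) → Regular graph k
  regular {k} almost-regular x = begin
    degree graph x                                                      ≡⟨ degree-∑ graph x ⟩
    ∑[ y < m * 2 ] bit (link (i , s) (remQuot 2 y))                     ≡⟨ ∑-combine m {2} (λ y → bit (link (i , s) (remQuot 2 y))) ⟩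
    ∑[ j < m ] ∑[ t < 2 ] bit (link (i , s) (remQuot 2 (combine j t)))  ≡⟨ sum-cong-≗ (λ j → sum-cong-≗ (λ t →
                                                                             cong (bit ∘ link (i , s)) (remQuot-combine {k = 2} j t))) ⟩
    ∑[ j < m ] ∑[ t < 2 ] bit (link (i , s) (j , t))                    ≡⟨ degree-lift i s ⟩
    degree H i + bit (isCentre i)                                       ≡⟨ almost-regular i ⟩
    k                                                                   ∎
    where
    open ≡-Reasoning
    i = proj₁ (remQuot {m} 2 x)
    s = proj₂ (remQuot {m} 2 x)

  lift : ∀ s {i j} → Walk H i j → Walk graph (combine i s) (combine j s)
  lift s = gmap (λ i → combine i s) (λ {i} {j} e → subst T (sym (adj-combine i s j s)) (same-side s e))
    where
    same-side : ∀ s {i j} → T (adj H i j) → T (link (i , s) (j , s))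
    same-side 0F e = e
    same-side 1F e = e

  bridge : ∀ s t → Walk graph (combine c s) (combine c t)
  bridge 0F 0F = ε
  bridge 1F 1F = ε
  bridge 0F 1F = subst T (sym (trans (adj-combine c 0F c 1F) centre-link)) _ ◅ ε
    where
    centre-link : isCentre c ∧ isCentre c ≡ true
    centre-link rewrite dec-true (c ≟ c) refl = refl
  bridge 1F 0F = reverse (λ {x} {y} → subst T (adj-sym graph x y)) (bridge 0F 1F)

  connected : Connected H → Connected graph
  connected H-connected x y = subst₂ (Walk graph) (combine-remQuot {m} 2 x) (combine-remQuot {m} 2 y)
    (lift s (H-connected i c) ◅◅ bridge s t ◅◅ lift t (H-connected c j))
    where
    i = proj₁ (remQuot {m} 2 x)
    s = proj₂ (remQuot {m} 2 x)
    j = proj₁ (remQuot {m} 2 y)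
    t = proj₂ (remQuot {m} 2 y)

  oddLabel-combine : ∀ (i : Fin m) (s : Fin 2) → oddLabel id (combine i s) ≡ does (s ≟ 0F)
  oddLabel-combine i s = trans (cong (_≡ᵇ 1) (begin
    (toℕ (combine i s) + 1) % 2      ≡⟨ cong (λ n → (n + 1) % 2) (toℕ-combine i s) ⟩
    (2 * toℕ i + toℕ s + 1) % 2      ≡⟨ cong (_% 2) (reorder (toℕ i) (toℕ s)) ⟩
    (toℕ s + 1 + toℕ i * 2) % 2      ≡⟨ [m+kn]%n≡m%n (toℕ s + 1) (toℕ i) 2 ⟩
    (toℕ s + 1) % 2                  ∎)) (by-side s)
    where
    open ≡-Reasoning
    reorder : ∀ a b → 2 * a + b + 1 ≡ b + 1 + a * 2
    reorder = solve-∀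
    by-side : ∀ (s : Fin 2) → ((toℕ s + 1) % 2 ≡ᵇ 1) ≡ does (s ≟ 0F)
    by-side 0F = refl
    by-side 1F = refl

  cut-from-side : ∀ (i : Fin m) (s : Fin 2) →
    ∑[ j < m ] ∑[ t < 2 ] bit (does (s ≟ 0F) ∧ link (i , s) (j , t) ∧ not (does (t ≟ 0F)))
      ≡ bit (does (s ≟ 0F) ∧ isCentre i)
  cut-from-side i 0F = trans (sum-cong-≗ only-bridge) (∑-centre (isCentre i))
    where
    only-bridge : ∀ j → bit (adj H i j ∧ false) + (bit ((isCentre i ∧ isCentre j) ∧ true) + 0)
                        ≡ bit (isCentre i ∧ isCentre j)
    only-bridge j rewrite ∧-zeroʳ (adj H i j) | ∧-identityʳ (isCentre i ∧ isCentre j) = +-identityʳ _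
  cut-from-side i 1F = sum-replicate-zero m

  one-crossing-edge : oddEdges graph id ≡ 1
  one-crossing-edge = begin
    oddEdges graph id
      ≡⟨ oddEdges≡cut graph id ⟩
    ∑[ x < m * 2 ] ∑[ y < m * 2 ] bit (S x ∧ adj graph x y ∧ not (S y))
      ≡⟨ ∑-combine m {2} (λ x → ∑[ y < m * 2 ] bit (S x ∧ adj graph x y ∧ not (S y))) ⟩
    ∑[ i < m ] ∑[ s < 2 ] ∑[ y < m * 2 ] bit (S (combine i s) ∧ adj graph (combine i s) y ∧ not (S y))
      ≡⟨ sum-cong-≗ (λ (i : Fin m) → sum-cong-≗ (λ (s : Fin 2) →
           ∑-combine m {2} (λ y → bit (S (combine i s) ∧ adj graph (combine i s) y ∧ not (S y))))) ⟩
    ∑[ i < m ] ∑[ s < 2 ] ∑[ j < m ] ∑[ t < 2 ]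
      bit (S (combine i s) ∧ adj graph (combine i s) (combine j t) ∧ not (S (combine j t)))
      ≡⟨ sum-cong-≗ (λ i → sum-cong-≗ (λ s → sum-cong-≗ (λ j → sum-cong-≗ (λ t → cong bit (decode i s j t))))) ⟩
    ∑[ i < m ] ∑[ s < 2 ] ∑[ j < m ] ∑[ t < 2 ] bit (does (s ≟ 0F) ∧ link (i , s) (j , t) ∧ not (does (t ≟ 0F)))
      ≡⟨ sum-cong-≗ (λ i → sum-cong-≗ (cut-from-side i)) ⟩
    ∑[ i < m ] ∑[ s < 2 ] bit (does (s ≟ 0F) ∧ isCentre i)
      ≡⟨ sum-cong-≗ (λ i → +-identityʳ (bit (isCentre i))) ⟩
    ∑[ i < m ] bit (isCentre i)
      ≡⟨ ∑-delta c ⟩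
    1 ∎
    where
    open ≡-Reasoning
    S = oddLabel {m * 2} id
    decode : ∀ (i : Fin m) (s : Fin 2) (j : Fin m) (t : Fin 2) →
      (S (combine i s) ∧ adj graph (combine i s) (combine j t) ∧ not (S (combine j t)))
        ≡ (does (s ≟ 0F) ∧ link (i , s) (j , t) ∧ not (does (t ≟ 0F)))
    decode i s j t = trans
      (cong₂ (λ a b → a ∧ adj graph (combine i s) (combine j t) ∧ not b) (oddLabel-combine i s) (oddLabel-combine j t))
      (cong (λ l → does (s ≟ 0F) ∧ l ∧ not (does (t ≟ 0F))) (adj-combine i s j t))

bridgedDouble-rna : ∀ {m} (H : Graph (suc m)) c → Connected H → RnaNumber (BridgedDouble.graph H c) 1
bridgedDouble-rna H c H-connected =
  (id , Identity.bijective _≡_ , one-crossing-edge) ,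
  λ f f-bijective → oddEdges-positive graph (connected H-connected) f f-bijective
  where open BridgedDouble H c

-- Vertex fzero is an apex joined to everything but the centre fsuc fzero; the
-- other 2p + 2 vertices, grouped into pairs by pair, are adjacent iff they lie
-- in different pairs. This is the complement of P₃ ∪ p K₂.
module ApexCocktailParty (p : ℕ) where

  pair : Fin (suc p * 2) → Fin (suc p)
  pair = quotient 2

  notCentre : Fin (suc p * 2) → Bool
  notCentre y = not (does (y ≟ fzero))

  adjacent : Fin (suc (suc p * 2)) → Fin (suc (suc p * 2)) → Bool
  adjacent fzero    fzero    = false
  adjacent fzero    (fsuc y) = notCentre y
  adjacent (fsuc x) fzero    = notCentre x
  adjacent (fsuc x) (fsuc y) = not (does (pair y ≟ pair x))

  graph : Graph (suc (suc p * 2))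
  graph = record { adj = adjacent ; sym = adjacent-sym ; irrefl = adjacent-irrefl }
    where
    adjacent-sym : ∀ u v → adjacent u v ≡ adjacent v u
    adjacent-sym fzero    fzero    = refl
    adjacent-sym fzero    (fsuc y) = refl
    adjacent-sym (fsuc x) fzero    = refl
    adjacent-sym (fsuc x) (fsuc y) = cong not (does-≟-sym (pair y) (pair x))
    adjacent-irrefl : ∀ v → adjacent v v ≡ false
    adjacent-irrefl fzero    = refl
    adjacent-irrefl (fsuc x) = cong not (dec-true (pair x ≟ pair x) refl)

  centre : Fin (suc (suc p * 2))
  centre = fsuc fzero

  almost-regular : ∀ v → degree graph v + bit (does (v ≟ centre)) ≡ suc (2 * p)
  almost-regular fzero = begin
    degree graph fzero + 0      ≡⟨ +-identityʳ _ ⟩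
    degree graph fzero          ≡⟨ degree-∑ graph fzero ⟩
    ∑[ y < suc (p * 2) ] 1      ≡⟨ ∑-ones (suc (p * 2)) ⟩
    suc (p * 2)                 ≡⟨ cong suc (*-comm p 2) ⟩
    suc (2 * p)                 ∎
    where open ≡-Reasoning
  almost-regular (fsuc x) = begin
    degree graph (fsuc x) + bit (does (x ≟ fzero))
      ≡⟨ cong (_+ bit (does (x ≟ fzero))) (degree-∑ graph (fsuc x)) ⟩
    bit (notCentre x) + others + bit (does (x ≟ fzero))
      ≡⟨ +-assoc (bit (notCentre x)) others _ ⟩
    bit (notCentre x) + (others + bit (does (x ≟ fzero)))
      ≡⟨ cong (bit (notCentre x) +_) (+-comm others _) ⟩
    bit (notCentre x) + (bit (does (x ≟ fzero)) + others)
      ≡⟨ sym (+-assoc (bit (notCentre x)) _ others) ⟩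
    bit (notCentre x) + bit (does (x ≟ fzero)) + others
      ≡⟨ cong (_+ others) (bit-not+bit (does (x ≟ fzero))) ⟩
    suc others
      ≡⟨ cong suc (∑-combine (suc p) {2} (λ y → bit (not (does (pair y ≟ pair x))))) ⟩
    suc (∑[ t < suc p ] ∑[ r < 2 ] bit (not (does (pair (combine t r) ≟ pair x))))
      ≡⟨ cong suc (sum-cong-≗ (λ t → sum-cong-≗ (λ r →
           cong (λ t′ → bit (not (does (t′ ≟ pair x)))) (cong proj₁ (remQuot-combine {k = 2} t r))))) ⟩
    suc (∑[ t < suc p ] (2 * bit (not (does (t ≟ pair x)))))
      ≡⟨ cong suc (sym (*-distribˡ-sum 2 (λ t → bit (not (does (t ≟ pair x)))))) ⟩
    suc (2 * ∑[ t < suc p ] bit (not (does (t ≟ pair x))))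
      ≡⟨ cong (λ n → suc (2 * n)) (∑-delta-complement (pair x)) ⟩
    suc (2 * p) ∎
    where
    open ≡-Reasoning
    others : ℕ
    others = ∑[ y < suc p * 2 ] bit (not (does (pair y ≟ pair x)))

apexCocktailParty-connected : ∀ q → Connected (ApexCocktailParty.graph (suc q))
apexCocktailParty-connected q = hub⇒connected (ApexCocktailParty.graph (suc q)) fzero to-apex
  where
  to-apex : ∀ v → Walk (ApexCocktailParty.graph (suc q)) v fzero
  to-apex fzero           = ε
  to-apex (fsuc fzero)    = _◅_ {j = fsuc (fsuc (fsuc fzero))} _ (_ ◅ ε)
  to-apex (fsuc (fsuc y)) = _ ◅ ε

regular-rna-one : ∀ q → Σ (Graph (suc (suc (suc q) * 2) * 2)) λ G →
  Connected G × Regular G (suc (2 * suc q)) × RnaNumber G 1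
regular-rna-one q =
  BridgedDouble.graph H centre ,
  BridgedDouble.connected H centre (apexCocktailParty-connected q) ,
  BridgedDouble.regular H centre almost-regular ,
  bridgedDouble-rna H centre (apexCocktailParty-connected q)
  where open ApexCocktailParty (suc q) using (centre; almost-regular) renaming (graph to H)

theorem6p8 : ((n : ℕ) → 1 ≤ n →
                ∃[ N ] (N ≤ 12 * n ∸ 2 × Σ (Graph N) (λ G →
                  Connected G × Regular G (4 * n ∸ 1) × RnaNumber G 1)))
             × (Σ (Graph 10) (λ G → Connected G × Regular G 3 × RnaNumber G 1))
             × ((N : ℕ) (G : Graph N) → Connected G → Regular G 3 → RnaNumber G 1 → 10 ≤ N)
theorem6p8 =
  upper-bound ,
  regular-rna-one 0 ,
  λ N G _ cubic rna → rna≡1⇒order-bound G cubic (s≤s (s≤s z≤n)) rna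
  where
  upper-bound : (n : ℕ) → 1 ≤ n → ∃[ N ] (N ≤ 12 * n ∸ 2 × Σ (Graph N) (λ G →
                  Connected G × Regular G (4 * n ∸ 1) × RnaNumber G 1))
  upper-bound (suc n) _ =
    let G , connected , regular , rna = regular-rna-one (2 * n)
    in _ , order≤ , G , connected , subst (Regular G) (degree≡ n) regular , rna
    where
    degree≡ : ∀ n → suc (2 * suc (2 * n)) ≡ n + 3 * suc n
    degree≡ = solve-∀
    order≡ : ∀ n → suc (suc (suc (2 * n)) * 2) * 2 ≡ 8 * n + 10
    order≡ = solve-∀
    bound≡ : ∀ n → 12 * suc n ≡ (12 * n + 10) + 2
    bound≡ = solve-∀
    order≤ : suc (suc (suc (2 * n)) * 2) * 2 ≤ 12 * suc n ∸ 2
    order≤ = begin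
      suc (suc (suc (2 * n)) * 2) * 2   ≡⟨ order≡ n ⟩
      8 * n + 10                        ≤⟨ +-monoˡ-≤ 10 (*-monoˡ-≤ n (m≤m+n 8 4)) ⟩
      12 * n + 10                       ≡⟨ sym (m+n∸n≡m (12 * n + 10) 2) ⟩
      (12 * n + 10) + 2 ∸ 2             ≡⟨ cong (_∸ 2) (sym (bound≡ n)) ⟩
      12 * suc n ∸ 2                    ∎
      where open ≤-Reasoning
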